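{- Let $G=(V,E)$ be a finite graph with $n=|V|$ nodes having a perfect matching $M^*$. For $(\rho,x)\in Q$, if $x$ is matched to $x^*$ in $\rho$, then $|f^{ -1}(\rho,x)|\le 3$, i.e., there are at most three pairs $((\sigma,u),\mathsf{R}(i))$ with $(\sigma,u)\in R_n$ and $i\in\{1,\dots,6\}$ such that $(\sigma,u)$ produces $(\rho,x)$ using rule $\mathsf{R}(i)$; in particular at most three elements $(\sigma,u)\in R_n$ have $(\rho,x)\in f(\sigma,u)$.
   Context: Ranking: given a bijection $\sigma:V\to[n]$ (permutation; $\sigma(u)$ is the rank of $u$), list all unordered pairs of distinct nodes lexicographically by $\sigma$ (write each pair $\{a,b\}$ with $\sigma(a)<\sigma(b)$; $\{a_1,b_1\}$ precedes $\{a_2,b_2\}$ iff $\sigma(a_1)<\sigma(a_2)$, or $a_1=a_2$ and $\sigma(b_1)<\sigma(b_2)$), and probe them in this order: when $\{a,b\}$ is probed, if both are unmatched and $\{a,b\}\in E$, match them to each other. The resulting matching is $M(\sigma)$; "matched in $\sigma$", "partner in $\sigma$" refer to $M(\sigma)$. For $u\in V$, $u^*$ denotes the partner of $u$ in the fixed perfect matching $M^*$. $\Omega$ is the set of all permutations. $\sigma_u^i$ is obtained from $\sigma$ by removing $u$ (keeping the relative order of the other nodes) and reinserting $u$ at rank $i$. $Q=\{(\sigma,v):\sigma\in\Omega,\ v\text{ matched in }\sigma\}$; $R_n=\{(\sigma,u):\sigma\in\Omega,\ \sigma(u)=n,\ u\text{ unmatched in }\sigma\}$. Rules: for $(\sigma,u)\in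 R_n$ and each $i\in[n]$, consider $\sigma_u^i$. If $u$ is unmatched in $\sigma_u^i$: $\mathsf{R}(1)$ produces $(\sigma_u^i,u^*)$; $\mathsf{R}(2)$ produces $(\sigma_u^i,v)$ where $v$ is the partner of $u^*$ in $\sigma_u^i$. If $u$ is matched in $\sigma_u^i$: $\mathsf{R}(3)$ produces $(\sigma_u^i,u)$; moreover (a) if $u^*$ is matched to $u$ in $\sigma_u^i$, $\mathsf{R}(4)$ produces $(\sigma_u^i,u^*)$; (b) if $u^*$ is matched to some $v\ne u$ in $\sigma_u^i$, $\mathsf{R}(5)$ produces $(\sigma_u^i,v)$; (c) if $u^*$ is unmatched in $\sigma_u^i$, $\mathsf{R}(6)$ produces $(\sigma_u^i,v_o)$ where $v_o$ is the partner of $u^*$ in $\sigma$. The relation $f$ relates $(\sigma,u)\in R_n$ to every instance it produces: $f(\sigma,u)$ is the set of all produced instances (it has $2n$ elements), and $f^{ -1}(\rho,x)=\{(\sigma,u)\in R_n:(\rho,x)\in f(\sigma,u)\}$. -}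

module Defs where

open import Data.Nat using (ℕ; zero; suc)
open import Data.Fin using (Fin; toℕ)
open import Data.Fin.Properties using (_≟_)
open import Data.Bool using (Bool; true; false; _∧_; if_then_else_)
open import Data.Maybe using (Maybe; just; nothing; is-nothing)
open import Data.List using (List; []; _∷_; _++_; map; foldl; filter; allFin; _∷ʳ_)
open import Data.List.Relation.Binary.Permutation.Propositional using (_↭_)
open import Data.Product using (_×_; _,_; Σ; ∃)
open import Relation.Nullary using (¬_)
open import Relation.Nullary.Decidable using (⌊_⌋; ¬?)
open import Relation.Binary.PropositionalEquality using (_≡_; _≢_)

record Graph (n : ℕ) : Set where
  field
    adj   : Fin n → Fin n → Bool
    sym   : ∀ a b → adj a b ≡ adj b a
    irrefl : ∀ a → adj a a ≡ false
open Graph public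

record PerfectMatching {n : ℕ} (G : Graph n) : Set where
  field
    star      : Fin n → Fin n
    star-invol : ∀ u → star (star u) ≡ u
    star-ne   : ∀ u → star u ≢ u
    star-edge : ∀ u → adj G u (star u) ≡ true
open PerfectMatching public

-- A ranking σ : V → [n] is represented by the list of the nodes in
-- increasing order of rank (the node at position k has rank k+1).
Ranking : ℕ → Set
Ranking n = List (Fin n)

IsRanking : ∀ {n} → Ranking n → Set
IsRanking {n} σ = σ ↭ allFin n

Ω : ℕ → Set
Ω n = Σ (Ranking n) IsRanking

-- All unordered pairs {a,b} (σ(a) < σ(b)) in lexicographic order by σ.
pairs : ∀ {A : Set} → List A → List (A × A)
pairs []       = []
pairs (a ∷ xs) = map (λ b → a , b) xs ++ pairs xs

State : ℕ → Set
State n = Fin n → Maybe (Fin n)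

emptyState : ∀ {n} → State n
emptyState _ = nothing

update : ∀ {n} → Fin n → Fin n → State n → State n
update a b m w with ⌊ w ≟ a ⌋ | ⌊ w ≟ b ⌋
... | true  | _     = just b
... | false | true  = just a
... | false | false = m w

probe : ∀ {n} → Graph n → State n → Fin n × Fin n → State n
probe G m (a , b) =
  if is-nothing (m a) ∧ is-nothing (m b) ∧ adj G a b
  then update a b m else m

mate : ∀ {n} → Graph n → Ranking n → State n
mate G σ = foldl (probe G) emptyState (pairs σ)

-- σ_u^i : remove u, reinsert at (0-indexed) position i, i.e. rank i+1.
insAt : ∀ {A : Set} → ℕ → A → List A → List A
insAt zero    v xs       = v ∷ xs
insAt (suc i) v []       = v ∷ []
insAt (suc i) v (x ∷ xs) = x ∷ insAt i v xs

reinsert : ∀ {n} → Ranking n → Fin n → Fin n → Ranking n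
reinsert σ u i = insAt (toℕ i) u (filter (λ w → ¬? (w ≟ u)) σ)

-- (σ,u) ∈ R_n : σ ∈ Ω, σ(u) = n (u is last), u unmatched in σ.
InRn : ∀ {n} → Graph n → Ranking n → Fin n → Set
InRn {n} G σ u =
  IsRanking σ × (∃ λ τ → σ ≡ τ ∷ʳ u) × mate G σ u ≡ nothing

InQ : ∀ {n} → Graph n → Ranking n → Fin n → Set
InQ G σ v = IsRanking σ × (∃ λ w → mate G σ v ≡ just w)

data Rule : Set where
  R1 R2 R3 R4 R5 R6 : Rule

RuleProduces : ∀ {n} (G : Graph n) → PerfectMatching G →
               Ranking n → Fin n → Ranking n → Rule → Fin n → Set
RuleProduces G M σ u ρ R1 x =
  mate G ρ u ≡ nothing × x ≡ star M u
RuleProduces G M σ u ρ R2 x =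
  mate G ρ u ≡ nothing × mate G ρ (star M u) ≡ just x
RuleProduces G M σ u ρ R3 x =
  (∃ λ w → mate G ρ u ≡ just w) × x ≡ u
RuleProduces G M σ u ρ R4 x =
  mate G ρ (star M u) ≡ just u × x ≡ star M u
RuleProduces G M σ u ρ R5 x =
  (∃ λ w → mate G ρ u ≡ just w) × mate G ρ (star M u) ≡ just x × x ≢ u
RuleProduces G M σ u ρ R6 x =
  (∃ λ w → mate G ρ u ≡ just w) × mate G ρ (star M u) ≡ nothing
    × mate G σ (star M u) ≡ just x

Produces : ∀ {n} (G : Graph n) → PerfectMatching G →
           Ranking n → Fin n → Rule → Ranking n → Fin n → Set
Produces {n} G M σ u r ρ x =
  InRn G σ u × (∃ λ (i : Fin n) → ρ ≡ reinsert σ u i × RuleProduces G M σ u ρ r x)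

InFInv : ∀ {n} (G : Graph n) → PerfectMatching G →
         Ranking n → Fin n → Ranking n → Fin n → Set
InFInv G M σ u ρ x = ∃ λ r → Produces G M σ u r ρ x

-- Since x is matched to x* in ρ, rules R1, R2 and R5 cannot produce (ρ, x), R3 forces u = x and R4
-- forces u = x*. For R6, u is free and last in σ, so M(σ) is the Ranking matching of ρ with u
-- deleted; deleting a node changes the set of matched nodes only at that node and one other, here
-- u*, which M(σ) matches to x. If u₁ ≠ u₂ both produced (ρ, x) by R6, then in ρ − u₁ the node x is
-- matched to u₁* while its neighbour u₂* stays free, so {x, u₁*} precedes {x, u₂*} in the probing
-- order of ρ; by symmetry also the converse, a contradiction. Finally σ = (ρ − u) · u is determined
-- by ρ and u, so each of R3, R4, R6 accounts for at most one producer.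
module Submission where

open import Defs hiding (sym)
open import Data.Bool using (true; false)
open import Data.Empty using (⊥; ⊥-elim)
open import Data.Fin using (Fin; zero; suc; toℕ)
open import Data.Fin.Properties using (_≟_; pigeonhole; <-irrefl)
open import Data.List using (List; []; _∷_; _++_; map; filter; foldl; lookup; length; allFin; _∷ʳ_)
open import Data.List.Properties using (filter-reject; filter-all; filter-idem; filter-++; ++-identityʳ)
open import Data.List.Membership.Propositional using (_∈_)
open import Data.List.Membership.Propositional.Properties using (∈-lookup)
open import Data.List.Relation.Binary.Permutation.Propositional using (_↭_; ↭-sym; ↭-trans; ↭⇒↭ₛ)
open import Data.List.Relation.Binary.Permutation.Propositional.Properties using (∷↭∷ʳ)
open import Data.List.Relation.Binary.Permutation.Setoid.Properties using (Unique-resp-↭)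
open import Data.List.Relation.Unary.All as All using (All)
open import Data.List.Relation.Unary.AllPairs using (_∷_)
open import Data.List.Relation.Unary.First using (First; [_]; _∷_)
open import Data.List.Relation.Unary.Unique.Propositional using (Unique)
open import Data.List.Relation.Unary.Unique.Propositional.Properties using (allFin⁺)
open import Data.Maybe using (Maybe; just; nothing; is-nothing)
import Data.Maybe.Properties as Maybe
open import Data.Maybe.Properties using (just-injective)
import Data.Bool.Properties as Bool
open import Data.Nat as ℕ using (ℕ; _≤_; _≤?_)
open import Data.Nat.Properties using (≰⇒>)
open import Data.Product using (∃; _×_; _,_; proj₁; proj₂)
open import Data.Product.Properties using (≡-dec)
open import Data.Sum using (_⊎_; inj₁; inj₂)
open import Function using (_∘_)
open import Level using (0ℓ)
open import Relation.Nullary using (¬_; Dec; yes; no)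
open import Relation.Nullary.Decidable using (¬?; _×-dec_; _⊎-dec_)
open import Relation.Unary using (Pred; Decidable; ∁; _⊆_)
open import Relation.Binary.PropositionalEquality
  using (_≡_; _≢_; refl; sym; trans; cong; cong₂; cong-app; subst; subst₂; ≢-sym; setoid; module ≡-Reasoning)

matched≢free : ∀ {A B : Set} (m : A → Maybe B) {w v c} → m w ≡ just c → m v ≡ nothing → w ≢ v
matched≢free m mw mv refl with () ← trans (sym mw) mv

module _ {A : Set} where

  Unique⇒lookup-injective : ∀ {xs : List A} → Unique xs → ∀ i j → lookup xs i ≡ lookup xs j → i ≡ j
  Unique⇒lookup-injective (_ ∷ _) zero zero _ = refl
  Unique⇒lookup-injective (x∉xs ∷ _) zero (suc j) eq = ⊥-elim (All.lookup x∉xs (∈-lookup j) eq)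
  Unique⇒lookup-injective (x∉xs ∷ _) (suc i) zero eq = ⊥-elim (All.lookup x∉xs (∈-lookup i) (sym eq))
  Unique⇒lookup-injective (_ ∷ xs!) (suc i) (suc j) eq = cong suc (Unique⇒lookup-injective xs! i j eq)

  length≤-injective-labelling : ∀ {k} {xs : List A} → Unique xs → (c : ∀ {x} → x ∈ xs → Fin k) →
    (∀ {x y} (p : x ∈ xs) (q : y ∈ xs) → c p ≡ c q → x ≡ y) → length xs ≤ k
  length≤-injective-labelling {k} {xs} xs! c c-inj with length xs ≤? k
  ... | yes xs≤k = xs≤k
  ... | no xs≰k with i , j , i<j , cᵢ≡cⱼ ← pigeonhole (≰⇒> xs≰k) (λ i → c (∈-lookup i)) =
    ⊥-elim (<-irrefl (Unique⇒lookup-injective xs! i j (c-inj _ _ cᵢ≡cⱼ)) i<j)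

module _ {A : Set} {P Q : Pred A 0ℓ} where

  First-filter⁻ : ∀ {R : Pred A 0ℓ} (R? : Decidable R) → Q ⊆ R →
                  ∀ xs → First (∁ Q) P (filter R? xs) → First (∁ Q) P xs
  First-filter⁻ R? Q⊆R (x ∷ xs) f with R? x
  First-filter⁻ R? Q⊆R (x ∷ xs) [ px ]     | yes _ = [ px ]
  First-filter⁻ R? Q⊆R (x ∷ xs) (¬qx ∷ f)  | yes _ = ¬qx ∷ First-filter⁻ R? Q⊆R xs f
  First-filter⁻ R? Q⊆R (x ∷ xs) f          | no ¬rx = (¬rx ∘ Q⊆R) ∷ First-filter⁻ R? Q⊆R xs f

  First-asym : (∀ {x} → P x → Q x → ⊥) → ∀ {xs} → First (∁ Q) P xs → First (∁ P) Q xs → ⊥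
  First-asym disjoint [ px ]   [ qx ]    = disjoint px qx
  First-asym disjoint [ px ]   (¬px ∷ _) = ¬px px
  First-asym disjoint (¬qx ∷ _) [ qx ]   = ¬qx qx
  First-asym disjoint (_ ∷ f)  (_ ∷ g)   = First-asym disjoint f g

module _ {n : ℕ} where

  update-here : ∀ a b (m : State n) → update a b m a ≡ just b
  update-here a b m with a ≟ a
  ... | yes _   = refl
  ... | no a≢a  = ⊥-elim (a≢a refl)

  update-there : ∀ {a b} (m : State n) → a ≢ b → update a b m b ≡ just a
  update-there {a} {b} m a≢b with b ≟ a | b ≟ b
  ... | yes b≡a | _      = ⊥-elim (a≢b (sym b≡a))
  ... | no _    | yes _  = refl
  ... | no _    | no b≢b = ⊥-elim (b≢b refl)

  update-elsewhere : ∀ {a b w} (m : State n) → w ≢ a → w ≢ b → update a b m w ≡ m w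
  update-elsewhere {a} {b} {w} m w≢a w≢b with w ≟ a | w ≟ b
  ... | yes w≡a | _       = ⊥-elim (w≢a w≡a)
  ... | no _    | yes w≡b = ⊥-elim (w≢b w≡b)
  ... | no _    | no _    = refl

  Joins : Fin n → Fin n → Pred (Fin n × Fin n) 0ℓ
  Joins x y p = p ≡ (x , y) ⊎ p ≡ (y , x)

  joins? : ∀ x y → Decidable (Joins x y)
  joins? x y p = ≡-dec _≟_ _≟_ p (x , y) ⊎-dec ≡-dec _≟_ _≟_ p (y , x)

  Joins-functional : ∀ {x y z p} → Joins x y p → Joins x z p → y ≡ z
  Joins-functional (inj₁ refl) (inj₁ refl) = refl
  Joins-functional (inj₁ refl) (inj₂ refl) = refl
  Joins-functional (inj₂ refl) (inj₁ refl) = refl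
  Joins-functional (inj₂ refl) (inj₂ refl) = refl

  update-origin : ∀ {a b w c} (m : State n) → m w ≡ nothing → update a b m w ≡ just c → Joins w c (a , b)
  update-origin {a} {b} {w} m mw e with w ≟ a | w ≟ b
  update-origin m mw refl | yes refl | _        = inj₁ refl
  update-origin m mw refl | no _     | yes refl = inj₂ refl
  update-origin m mw e    | no _     | no _     = ⊥-elim (matched≢free m e mw refl)

  update-cong : ∀ {a b} {m m′ : State n} w → (w ≢ a → w ≢ b → m w ≡ m′ w) → update a b m w ≡ update a b m′ w
  update-cong {a} {b} w outside with w ≟ a | w ≟ b
  ... | yes _  | _      = refl
  ... | no _   | yes _  = refl
  ... | no w≢a | no w≢b = outside w≢a w≢b

  SameStatus : State n → State n → Fin n → Set
  SameStatus m m′ w = is-nothing (m w) ≡ is-nothing (m′ w)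

  update-sameStatus : ∀ {a b} {m m′ : State n} w → (w ≢ a → w ≢ b → SameStatus m m′ w) →
                      SameStatus (update a b m) (update a b m′) w
  update-sameStatus {a} {b} w outside with w ≟ a | w ≟ b
  ... | yes _  | _      = refl
  ... | no _   | yes _  = refl
  ... | no w≢a | no w≢b = outside w≢a w≢b

  update-sameStatusˡ : ∀ {a b} {m m′ : State n} w → (w ≡ a ⊎ w ≡ b → is-nothing (m′ w) ≡ false) →
                       (w ≢ a → w ≢ b → SameStatus m m′ w) → SameStatus (update a b m) m′ w
  update-sameStatusˡ {a} {b} w endpoint outside with w ≟ a | w ≟ b
  ... | yes w≡a | _       = sym (endpoint (inj₁ w≡a))
  ... | no _    | yes w≡b = sym (endpoint (inj₂ w≡b))
  ... | no w≢a  | no w≢b  = outside w≢a w≢b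

  sameStatus-update-elsewhere : ∀ {a b} {m m′ : State n} → (∀ w → m w ≡ m′ w) →
                                ∀ {w} → w ≢ a → w ≢ b → SameStatus (update a b m) m′ w
  sameStatus-update-elsewhere {m = m} m≗m′ {w} w≢a w≢b =
    cong is-nothing (trans (update-elsewhere m w≢a w≢b) (m≗m′ w))

  AgreeOutside : Fin n → Fin n → State n → State n → Set
  AgreeOutside u z m m′ = ∀ w → w ≢ u → w ≢ z → SameStatus m m′ w

  AgreeOutside-sym : ∀ {u z m m′} → AgreeOutside u z m m′ → AgreeOutside u z m′ m
  AgreeOutside-sym agree w w≢u w≢z = sym (agree w w≢u w≢z)

  disagree⇒exception : ∀ {u z m m′ w c} → AgreeOutside u z m m′ →
                       w ≢ u → m w ≡ nothing → m′ w ≡ just c → w ≡ z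
  disagree⇒exception {z = z} {w = w} agree w≢u mw m′w with w ≟ z
  ... | yes w≡z = w≡z
  ... | no w≢z with () ← trans (sym (cong is-nothing mw)) (trans (agree w w≢u w≢z) (cong is-nothing m′w))

  Avoids : Fin n → Pred (Fin n × Fin n) 0ℓ
  Avoids u (a , b) = a ≢ u × b ≢ u

  avoids? : ∀ u → Decidable (Avoids u)
  avoids? u (a , b) = ¬? (a ≟ u) ×-dec ¬? (b ≟ u)

  without : Fin n → Ranking n → Ranking n
  without u = filter (λ w → ¬? (w ≟ u))

  without-head : ∀ u (σ : Ranking n) → without u (u ∷ σ) ≡ without u σ
  without-head u σ = filter-reject (λ w → ¬? (w ≟ u)) (λ u≢u → u≢u refl)

  filter-avoids-map-self : ∀ u (σ : Ranking n) → filter (avoids? u) (map (u ,_) σ) ≡ []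
  filter-avoids-map-self u []      = refl
  filter-avoids-map-self u (b ∷ σ) with u ≟ u
  ... | yes _   = filter-avoids-map-self u σ
  ... | no u≢u  = ⊥-elim (u≢u refl)

  filter-avoids-map : ∀ {u a} → a ≢ u → ∀ (σ : Ranking n) →
                      filter (avoids? u) (map (a ,_) σ) ≡ map (a ,_) (without u σ)
  filter-avoids-map         a≢u []      = refl
  filter-avoids-map {u} {a} a≢u (b ∷ σ) with a ≟ u | b ≟ u
  ... | yes a≡u | _     = ⊥-elim (a≢u a≡u)
  ... | no _    | yes _ = filter-avoids-map a≢u σ
  ... | no _    | no _  = cong ((a , b) ∷_) (filter-avoids-map a≢u σ)

  pairs-without : ∀ u (σ : Ranking n) → pairs (without u σ) ≡ filter (avoids? u) (pairs σ)
  pairs-without u []      = refl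
  pairs-without u (a ∷ σ) with a ≟ u
  ... | yes refl = begin
    pairs (without a σ)
      ≡⟨ pairs-without a σ ⟩
    filter (avoids? a) (pairs σ)
      ≡⟨ cong (_++ filter (avoids? a) (pairs σ)) (filter-avoids-map-self a σ) ⟨
    filter (avoids? a) (map (a ,_) σ) ++ filter (avoids? a) (pairs σ)
      ≡⟨ filter-++ (avoids? a) (map (a ,_) σ) (pairs σ) ⟨
    filter (avoids? a) (pairs (a ∷ σ))
      ∎
    where open ≡-Reasoning
  ... | no a≢u = begin
    map (a ,_) (without u σ) ++ pairs (without u σ)
      ≡⟨ cong₂ _++_ (sym (filter-avoids-map a≢u σ)) (pairs-without u σ) ⟩
    filter (avoids? u) (map (a ,_) σ) ++ filter (avoids? u) (pairs σ)
      ≡⟨ filter-++ (avoids? u) (map (a ,_) σ) (pairs σ) ⟨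
    filter (avoids? u) (pairs (a ∷ σ))
      ∎
    where open ≡-Reasoning

  without-insAt : ∀ u k (σ : Ranking n) → without u (insAt k u σ) ≡ without u σ
  without-insAt u ℕ.zero    σ       = without-head u σ
  without-insAt u (ℕ.suc k) []      = without-head u []
  without-insAt u (ℕ.suc k) (w ∷ σ) with w ≟ u
  ... | yes _ = without-insAt u k σ
  ... | no _  = cong (w ∷_) (without-insAt u k σ)

  without-reinsert : ∀ σ u (i : Fin n) → without u (reinsert σ u i) ≡ without u σ
  without-reinsert σ u i =
    trans (without-insAt u (toℕ i) (without u σ)) (filter-idem (λ w → ¬? (w ≟ u)) σ)

  ↭allFin⇒init-fresh : ∀ {τ u} → τ ∷ʳ u ↭ allFin n → All (_≢ u) τ
  ↭allFin⇒init-fresh {τ} {u} τu↭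
    with u∉τ ∷ _ ← Unique-resp-↭ (setoid _) (↭⇒↭ₛ (↭-sym (↭-trans (∷↭∷ʳ u τ) τu↭))) (allFin⁺ n) =
    All.map ≢-sym u∉τ

  without-∷ʳ : ∀ {u} {τ : Ranking n} → All (_≢ u) τ → without u (τ ∷ʳ u) ≡ τ
  without-∷ʳ {u} {τ} τ∌u = begin
    without u (τ ++ u ∷ [])             ≡⟨ filter-++ (λ w → ¬? (w ≟ u)) τ (u ∷ []) ⟩
    without u τ ++ without u (u ∷ [])   ≡⟨ cong₂ _++_ (filter-all _ τ∌u) (without-head u []) ⟩
    τ ++ []                             ≡⟨ ++-identityʳ τ ⟩
    τ                                   ∎
    where open ≡-Reasoning

module _ {n : ℕ} (G : Graph n) where

  run : State n → List (Fin n × Fin n) → State n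
  run = foldl (probe G)

  adj⇒≢ : ∀ {a b} → adj G a b ≡ true → a ≢ b
  adj⇒≢ {a} ab refl with () ← trans (sym ab) (irrefl G a)

  Matchable : State n → Fin n → Fin n → Set
  Matchable m a b = m a ≡ nothing × m b ≡ nothing × adj G a b ≡ true

  matchable? : ∀ m a b → Dec (Matchable m a b)
  matchable? m a b =
    Maybe.≡-dec _≟_ (m a) nothing ×-dec Maybe.≡-dec _≟_ (m b) nothing ×-dec adj G a b Bool.≟ true

  probe-matches : ∀ {m a b} → Matchable m a b → probe G m (a , b) ≡ update a b m
  probe-matches (ma , mb , ab) rewrite ma | mb | ab = refl

  probe-skips : ∀ {m a b} → ¬ Matchable m a b → probe G m (a , b) ≡ m
  probe-skips {m} {a} {b} ¬mt with m a | m b | adj G a b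
  ... | nothing | nothing | true  = ⊥-elim (¬mt (refl , refl , refl))
  ... | nothing | nothing | false = refl
  ... | nothing | just _  | _     = refl
  ... | just _  | _       | _     = refl

  IsMatching : State n → Set
  IsMatching m = ∀ {a b} → m a ≡ just b → m b ≡ just a × adj G a b ≡ true

  update-isMatching : ∀ {m a b} → IsMatching m → Matchable m a b → IsMatching (update a b m)
  update-isMatching {m} {a} {b} m-matching (ma , mb , ab) {w} {c} e with w ≟ a | w ≟ b
  ... | yes refl | _        with refl ← e = update-there m (adj⇒≢ ab) , ab
  ... | no _     | yes refl with refl ← e = update-here a b m , trans (Graph.sym G w a) ab
  ... | no w≢a   | no w≢b   =
    trans (update-elsewhere m (matched≢free m mc ma) (matched≢free m mc mb)) mc , wc
    where
      mc = proj₁ (m-matching e)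
      wc = proj₂ (m-matching e)

  probe-isMatching : ∀ {m} p → IsMatching m → IsMatching (probe G m p)
  probe-isMatching {m} (a , b) m-matching with matchable? m a b
  ... | yes mt = subst IsMatching (sym (probe-matches mt)) (update-isMatching m-matching mt)
  ... | no ¬mt = subst IsMatching (sym (probe-skips ¬mt)) m-matching

  run-isMatching : ∀ L {m} → IsMatching m → IsMatching (run m L)
  run-isMatching []      m-matching = m-matching
  run-isMatching (p ∷ L) {m} m-matching = run-isMatching L (probe-isMatching {m} p m-matching)

  mate-isMatching : ∀ σ → IsMatching (mate G σ)
  mate-isMatching σ = run-isMatching (pairs σ) (λ ())

  probe-keeps-partner : ∀ {m} p {w c} → m w ≡ just c → probe G m p w ≡ just c
  probe-keeps-partner {m} (a , b) {w} mw with matchable? m a b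
  ... | yes mt@(ma , mb , _) =
    trans (cong-app (probe-matches mt) w)
          (trans (update-elsewhere m (matched≢free m mw ma) (matched≢free m mw mb)) mw)
  ... | no ¬mt = trans (cong-app (probe-skips ¬mt) w) mw

  run-keeps-partner : ∀ L {m w c} → m w ≡ just c → run m L w ≡ just c
  run-keeps-partner []      mw = mw
  run-keeps-partner (p ∷ L) {m} mw = run-keeps-partner L (probe-keeps-partner {m} p mw)

  free-before-run : ∀ L {m w} → run m L w ≡ nothing → m w ≡ nothing
  free-before-run L {m} {w} free with m w in mw
  ... | nothing = refl
  ... | just _  = ⊥-elim (matched≢free (run m L) (run-keeps-partner L mw) free refl)

  probe-origin : ∀ {m} p {w c} → m w ≡ nothing → probe G m p w ≡ just c → Joins w c p
  probe-origin {m} (a , b) {w} mw e with matchable? m a b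
  ... | yes mt = update-origin m mw (trans (sym (cong-app (probe-matches mt) w)) e)
  ... | no ¬mt = ⊥-elim (matched≢free m (trans (sym (cong-app (probe-skips ¬mt) w)) e) mw refl)

  probe-joins : ∀ {m x z} p → Joins x z p → Matchable m x z → probe G m p x ≡ just z
  probe-joins {m} {x} {z} _ (inj₁ refl) mt = trans (cong-app (probe-matches mt) x) (update-here x z m)
  probe-joins {m} {x} {z} _ (inj₂ refl) (mx , mz , xz) =
    trans (cong-app (probe-matches (mz , mx , trans (Graph.sym G z x) xz)) x)
          (update-there m (≢-sym (adj⇒≢ xz)))

  -- Had {x, z} come first, both x and z would have been free when it was probed.
  matched-before : ∀ L {m x y z} → m x ≡ nothing → run m L x ≡ just y → run m L z ≡ nothing →
                   adj G x z ≡ true → y ≢ z → First (∁ (Joins x z)) (Joins x y) L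
  matched-before []      {m} mx rx _  _  _   = ⊥-elim (matched≢free m rx mx refl)
  matched-before (p ∷ L) {m} {x} {y} {z} mx rx rz xz y≢z with joins? x y p
  ... | yes xy = [ xy ]
  ... | no ¬xy = ¬xz ∷ matched-before L mx′ rx rz xz y≢z
    where
      ¬xz : ¬ Joins x z p
      ¬xz j = y≢z (just-injective (trans (sym rx)
                (run-keeps-partner L (probe-joins {m} p j (mx , free-before-run (p ∷ L) {m} rz , xz)))))
      mx′ : probe G m p x ≡ nothing
      mx′ with probe G m p x in e
      ... | nothing = refl
      ... | just c  = ⊥-elim (¬xy (subst (λ c → Joins x c p)
                        (just-injective (trans (sym (run-keeps-partner L e)) rx)) (probe-origin {m} p mx e)))

  matchable-cong : ∀ {m m′ a b} → (∀ w → m w ≡ m′ w) → Matchable m a b → Matchable m′ a b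
  matchable-cong {a = a} {b} m≗m′ (ma , mb , ab) = trans (sym (m≗m′ a)) ma , trans (sym (m≗m′ b)) mb , ab

  -- m runs Ranking on a list of pairs, m′ on the same list with the pairs at u removed. They coincide
  -- while u is free; afterwards they differ along an alternating path, which changes the set of
  -- matched nodes only at u and at its other end.
  record NearlyEqual (u : Fin n) (m m′ : State n) : Set where
    field
      equal-if-free : m u ≡ nothing → ∀ w → m w ≡ m′ w
      exception     : Fin n
      agree         : AgreeOutside u exception m m′

  nearlyEqual-update : ∀ {u m m′ a b} → a ≢ u → b ≢ u → NearlyEqual u m m′ →
                       NearlyEqual u (update a b m) (update a b m′)
  nearlyEqual-update {u} {m} a≢u b≢u ne = record
    { equal-if-free = λ u-free w → update-cong w λ _ _ →
        equal-if-free (trans (sym (update-elsewhere m (≢-sym a≢u) (≢-sym b≢u))) u-free) w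
    ; exception = exception
    ; agree = λ w w≢u w≢z → update-sameStatus w λ _ _ → agree w w≢u w≢z
    }
    where open NearlyEqual ne

  agreeOutside-update : ∀ {u z m m′ a b} → a ≢ u → b ≢ u → Matchable m a b → ¬ Matchable m′ a b →
                        AgreeOutside u z m m′ → ∃ λ z′ → AgreeOutside u z′ (update a b m) m′
  agreeOutside-update {u} {z} {m} {m′} {a} {b} a≢u b≢u (ma , mb , ab) ¬mt′ agree
    with m′ a in m′a | m′ b in m′b
  ... | just _  | _      = b , λ w w≢u w≢b → update-sameStatusˡ {m = m} {m′} w
          (λ { (inj₁ w≡a) → trans (cong (is-nothing ∘ m′) w≡a) (cong is-nothing m′a)
             ; (inj₂ w≡b) → ⊥-elim (w≢b w≡b) })
          (λ w≢a _ → agree w w≢u λ w≡z → w≢a (trans w≡z (sym (disagree⇒exception agree a≢u ma m′a))))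
  ... | nothing | just _ = a , λ w w≢u w≢a → update-sameStatusˡ {m = m} {m′} w
          (λ { (inj₁ w≡a) → ⊥-elim (w≢a w≡a)
             ; (inj₂ w≡b) → trans (cong (is-nothing ∘ m′) w≡b) (cong is-nothing m′b) })
          (λ _ w≢b → agree w w≢u λ w≡z → w≢b (trans w≡z (sym (disagree⇒exception agree b≢u mb m′b))))
  ... | nothing | nothing = ⊥-elim (¬mt′ (refl , refl , ab))

  nearlyEqual-probe : ∀ {u m m′ a b} → a ≢ u → b ≢ u → NearlyEqual u m m′ →
                      NearlyEqual u (probe G m (a , b)) (probe G m′ (a , b))
  nearlyEqual-probe {u} {m} {m′} {a} {b} a≢u b≢u ne with matchable? m a b | matchable? m′ a b
  ... | yes mt | yes mt′ =
    subst₂ (NearlyEqual u) (sym (probe-matches mt)) (sym (probe-matches mt′)) (nearlyEqual-update a≢u b≢u ne)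
  ... | no ¬mt | no ¬mt′ =
    subst₂ (NearlyEqual u) (sym (probe-skips ¬mt)) (sym (probe-skips ¬mt′)) ne
  ... | yes mt | no ¬mt′ =
    subst₂ (NearlyEqual u) (sym (probe-matches mt)) (sym (probe-skips ¬mt′)) record
      { equal-if-free = λ u-free → ⊥-elim (¬mt′ (matchable-cong
          (equal-if-free (trans (sym (update-elsewhere m (≢-sym a≢u) (≢-sym b≢u))) u-free)) mt))
      ; exception = proj₁ shifted
      ; agree = proj₂ shifted
      }
    where
      open NearlyEqual ne
      shifted = agreeOutside-update a≢u b≢u mt ¬mt′ agree
  ... | no ¬mt | yes mt′ =
    subst₂ (NearlyEqual u) (sym (probe-skips ¬mt)) (sym (probe-matches mt′)) record
      { equal-if-free = λ u-free → ⊥-elim (¬mt (matchable-cong (sym ∘ equal-if-free u-free) mt′))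
      ; exception = proj₁ shifted
      ; agree = AgreeOutside-sym (proj₂ shifted)
      }
    where
      open NearlyEqual ne
      shifted = agreeOutside-update a≢u b≢u mt′ ¬mt (AgreeOutside-sym agree)

  nearlyEqual-update-touching : ∀ {u m m′ a b} → ¬ Avoids u (a , b) → Matchable m a b → NearlyEqual u m m′ →
                                NearlyEqual u (update a b m) m′
  nearlyEqual-update-touching {u} {m} {m′} {a} {b} touches (ma , mb , ab) ne with a ≟ u | b ≟ u
  ... | yes refl | _ = record
    { equal-if-free = λ u-free → ⊥-elim (matched≢free (update a b m) {u} {u} (update-here a b m) u-free refl)
    ; exception = b
    ; agree = λ w w≢a w≢b → sameStatus-update-elsewhere (NearlyEqual.equal-if-free ne ma) w≢a w≢b
    }
  ... | no _ | yes refl = record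
    { equal-if-free = λ u-free →
        ⊥-elim (matched≢free (update a b m) {u} {u} (update-there m (adj⇒≢ ab)) u-free refl)
    ; exception = a
    ; agree = λ w w≢b w≢a → sameStatus-update-elsewhere (NearlyEqual.equal-if-free ne mb) w≢a w≢b
    }
  ... | no a≢u | no b≢u = ⊥-elim (touches (a≢u , b≢u))

  nearlyEqual-probe-touching : ∀ {u m m′ a b} → ¬ Avoids u (a , b) → NearlyEqual u m m′ →
                               NearlyEqual u (probe G m (a , b)) m′
  nearlyEqual-probe-touching {u} {m} {m′} {a} {b} touches ne with matchable? m a b
  ... | yes mt =
    subst (λ s → NearlyEqual u s m′) (sym (probe-matches mt)) (nearlyEqual-update-touching touches mt ne)
  ... | no ¬mt = subst (λ s → NearlyEqual u s m′) (sym (probe-skips ¬mt)) ne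

  nearlyEqual-run : ∀ {u} L {m m′} → NearlyEqual u m m′ →
                    NearlyEqual u (run m L) (run m′ (filter (avoids? u) L))
  nearlyEqual-run         []            ne = ne
  nearlyEqual-run {u} ((a , b) ∷ L) ne with a ≟ u | b ≟ u
  ... | yes a≡u | _       = nearlyEqual-run L (nearlyEqual-probe-touching (λ (a≢u , _) → a≢u a≡u) ne)
  ... | no _    | yes b≡u = nearlyEqual-run L (nearlyEqual-probe-touching (λ (_ , b≢u) → b≢u b≡u) ne)
  ... | no a≢u  | no b≢u  = nearlyEqual-run L (nearlyEqual-probe a≢u b≢u ne)

  nearlyEqual-empty : ∀ {u} → NearlyEqual u emptyState emptyState
  nearlyEqual-empty {u} = record { equal-if-free = λ _ _ → refl ; exception = u ; agree = λ _ _ _ → refl }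

  mate-without : ∀ u σ → NearlyEqual u (mate G σ) (mate G (without u σ))
  mate-without u σ = subst (NearlyEqual u (mate G σ)) (cong (run emptyState) (sym (pairs-without u σ)))
                           (nearlyEqual-run (pairs σ) nearlyEqual-empty)

module _ {n : ℕ} {G : Graph n} (M : PerfectMatching G) where

  producer-ranking : ∀ {σ u r ρ x} → Produces G M σ u r ρ x → σ ≡ without u ρ ∷ʳ u
  producer-ranking {u = u} ((σ↭ , (τ , refl) , _) , i , refl , _) =
    cong (_∷ʳ u) (sym (trans (without-reinsert (τ ∷ʳ u) u i) (without-∷ʳ (↭allFin⇒init-fresh σ↭))))

  star-injective : ∀ {a b} → star M a ≡ star M b → a ≡ b
  star-injective {a} {b} e = trans (sym (star-invol M a)) (trans (cong (star M) e) (star-invol M b))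

  -- Rule R6 for (σ, u) restated in terms of ρ: as u is free and last in σ, M(σ) is the Ranking
  -- matching of ρ with u deleted.
  record R6Witness (ρ : Ranking n) (x u : Fin n) : Set where
    field
      star-matched-without : mate G (without u ρ) (star M u) ≡ just x
      free-without         : mate G (without u ρ) u ≡ nothing
      star-free            : mate G ρ (star M u) ≡ nothing
      matched              : ∃ λ w → mate G ρ u ≡ just w

  r6-witness : ∀ {σ u ρ x} → Produces G M σ u R6 ρ x → R6Witness ρ x u
  r6-witness {σ} {u} ((_ , _ , u-free) , i , refl , (ρu , ρu*-free , σu*)) = record
    { star-matched-without = trans (sym (same (star M u))) σu*
    ; free-without         = trans (sym (same u)) u-free
    ; star-free            = ρu*-free
    ; matched              = ρu
    }
    where
      same : ∀ w → mate G σ w ≡ mate G (without u (reinsert σ u i)) w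
      same w = trans (NearlyEqual.equal-if-free (mate-without G u σ) u-free w)
                     (cong (λ τ → mate G τ w) (sym (without-reinsert σ u i)))

  -- In ρ − u₁, x is matched to u₁* while its neighbour u₂* stays free: u₂* is free in ρ, and u₁* is
  -- already the one node besides u₁ whose status changes.
  joins-order : ∀ {ρ x u₁ u₂} → R6Witness ρ x u₁ → R6Witness ρ x u₂ → u₁ ≢ u₂ →
                First (∁ (Joins x (star M u₂))) (Joins x (star M u₁)) (pairs ρ)
  joins-order {ρ} {x} {u₁} {u₂} w₁ w₂ u₁≢u₂ =
    First-filter⁻ (avoids? u₁) avoids (pairs ρ)
      (subst (First (∁ (Joins x (star M u₂))) (Joins x (star M u₁))) (pairs-without u₁ ρ)
        (matched-before G (pairs (without u₁ ρ)) refl x-matched s₂-free x-adj-s₂ (u₁≢u₂ ∘ star-injective)))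
    where
      module W₁ = R6Witness w₁
      module W₂ = R6Witness w₂
      m₁ = mate G (without u₁ ρ)
      x-matched : m₁ x ≡ just (star M u₁)
      x-matched = proj₁ (mate-isMatching G (without u₁ ρ) W₁.star-matched-without)
      x-adj-s₂ : adj G x (star M u₂) ≡ true
      x-adj-s₂ = trans (Graph.sym G x (star M u₂))
                       (proj₂ (mate-isMatching G (without u₂ ρ) W₂.star-matched-without))
      x≢u₁ : x ≢ u₁
      x≢u₁ = matched≢free m₁ x-matched W₁.free-without
      s₂≢u₁ : star M u₂ ≢ u₁
      s₂≢u₁ s₂≡u₁ = matched≢free (mate G ρ) (proj₂ W₁.matched) W₂.star-free (sym s₂≡u₁)
      open NearlyEqual (mate-without G u₁ ρ) using (exception; agree)
      to-exception : ∀ {w c} → w ≢ u₁ → mate G ρ w ≡ nothing → m₁ w ≡ just c → w ≡ exception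
      to-exception = disagree⇒exception agree
      s₂-free : m₁ (star M u₂) ≡ nothing
      s₂-free with m₁ (star M u₂) in s₂-matched
      ... | nothing = refl
      ... | just _  = ⊥-elim (u₁≢u₂ (star-injective (trans
              (to-exception (star-ne M u₁) W₁.star-free W₁.star-matched-without)
              (sym (to-exception s₂≢u₁ W₂.star-free s₂-matched)))))
      avoids : Joins x (star M u₂) ⊆ Avoids u₁
      avoids (inj₁ refl) = x≢u₁ , s₂≢u₁
      avoids (inj₂ refl) = s₂≢u₁ , x≢u₁

  r6-unique : ∀ {ρ x u₁ u₂} → R6Witness ρ x u₁ → R6Witness ρ x u₂ → u₁ ≡ u₂
  r6-unique {u₁ = u₁} {u₂} w₁ w₂ with u₁ ≟ u₂
  ... | yes u₁≡u₂ = u₁≡u₂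
  ... | no u₁≢u₂  = ⊥-elim (First-asym (λ j₁ j₂ → u₁≢u₂ (star-injective (Joins-functional j₁ j₂)))
                                       (joins-order w₁ w₂ u₁≢u₂) (joins-order w₂ w₁ (≢-sym u₁≢u₂)))

  data Production (ρ : Ranking n) (x u : Fin n) : Rule → Set where
    by-R3 : u ≡ x → Production ρ x u R3
    by-R4 : u ≡ star M x → Production ρ x u R4
    by-R6 : R6Witness ρ x u → Production ρ x u R6

  production-index : ∀ {ρ x u r} → Production ρ x u r → Fin 3
  production-index (by-R3 _) = zero
  production-index (by-R4 _) = suc zero
  production-index (by-R6 _) = suc (suc zero)

  production-injective : ∀ {ρ x u u′ r r′} (π : Production ρ x u r) (π′ : Production ρ x u′ r′) →
                         production-index π ≡ production-index π′ → u ≡ u′ × r ≡ r′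
  production-injective (by-R3 refl) (by-R3 refl) _  = refl , refl
  production-injective (by-R4 refl) (by-R4 refl) _  = refl , refl
  production-injective (by-R6 w)    (by-R6 w′)   _  = r6-unique w w′ , refl
  production-injective (by-R3 _)    (by-R4 _)    ()
  production-injective (by-R3 _)    (by-R6 _)    ()
  production-injective (by-R4 _)    (by-R3 _)    ()
  production-injective (by-R4 _)    (by-R6 _)    ()
  production-injective (by-R6 _)    (by-R3 _)    ()
  production-injective (by-R6 _)    (by-R4 _)    ()

  star-partner⇒≡ : ∀ {ρ x u} → mate G ρ x ≡ just (star M x) → mate G ρ (star M u) ≡ just x → u ≡ x
  star-partner⇒≡ {ρ} ρx ρu* =
    star-injective (just-injective (trans (sym (proj₁ (mate-isMatching G ρ ρu*))) ρx))

  production : ∀ {σ u r ρ x} → mate G ρ x ≡ just (star M x) → Produces G M σ u r ρ x → Production ρ x u r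
  production {u = u} {R1} {ρ} ρx (_ , _ , _ , u-free , refl) =
    ⊥-elim (matched≢free (mate G ρ) (proj₁ (mate-isMatching G ρ ρx)) u-free (star-invol M u))
  production {u = u} {R2} {ρ} ρx (_ , _ , _ , u-free , ρu*) =
    ⊥-elim (matched≢free (mate G ρ) ρx u-free (sym (star-partner⇒≡ {ρ} ρx ρu*)))
  production {r = R3} ρx (_ , _ , _ , _ , refl) = by-R3 refl
  production {u = u} {R4} ρx (_ , _ , _ , _ , refl) = by-R4 (sym (star-invol M u))
  production {r = R5} {ρ} ρx (_ , _ , _ , _ , ρu* , x≢u) = ⊥-elim (x≢u (sym (star-partner⇒≡ {ρ} ρx ρu*)))
  production {r = R6} ρx p = by-R6 (r6-witness p)

  producer-unique : ∀ {ρ x σ u r σ′ u′ r′} (ρx : mate G ρ x ≡ just (star M x))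
                    (p : Produces G M σ u r ρ x) (p′ : Produces G M σ′ u′ r′ ρ x) →
                    production-index (production ρx p) ≡ production-index (production ρx p′) →
                    (σ , u , r) ≡ (σ′ , u′ , r′)
  producer-unique ρx p p′ same with production-injective (production ρx p) (production ρx p′) same
  ... | refl , refl = cong (_, _) (trans (producer-ranking p) (sym (producer-ranking p′)))

  producers-≤3 : ∀ {ρ x} → mate G ρ x ≡ just (star M x) → (L : List (Ranking n × Fin n × Rule)) → Unique L →
                 All (λ t → Produces G M (proj₁ t) (proj₁ (proj₂ t)) (proj₂ (proj₂ t)) ρ x) L → length L ≤ 3
  producers-≤3 ρx L L! producers = length≤-injective-labelling L!
    (λ t∈L → production-index (production ρx (All.lookup producers t∈L)))
    (λ s∈L t∈L → producer-unique ρx (All.lookup producers s∈L) (All.lookup producers t∈L))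

  producer-pairs-≤3 : ∀ {ρ x} → mate G ρ x ≡ just (star M x) → (L : List (Ranking n × Fin n)) → Unique L →
                      All (λ t → InFInv G M (proj₁ t) (proj₂ t) ρ x) L → length L ≤ 3
  producer-pairs-≤3 ρx L L! producers = length≤-injective-labelling L!
    (λ t∈L → production-index (production ρx (proj₂ (All.lookup producers t∈L))))
    (λ s∈L t∈L same → cong (λ (σ , u , _) → σ , u)
      (producer-unique ρx (proj₂ (All.lookup producers s∈L)) (proj₂ (All.lookup producers t∈L)) same))

lemma5 : {n : ℕ} (G : Graph n) (M : PerfectMatching G) (ρ : Ranking n) (x : Fin n)
    → InQ G ρ x → mate G ρ x ≡ just (star M x)
    → ((L : List (Ranking n × Fin n × Rule)) → Unique L
        → All (λ t → Produces G M (proj₁ t) (proj₁ (proj₂ t)) (proj₂ (proj₂ t)) ρ x) L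
        → length L ≤ 3)
      × ((L : List (Ranking n × Fin n)) → Unique L
        → All (λ t → InFInv G M (proj₁ t) (proj₂ t) ρ x) L
        → length L ≤ 3)
lemma5 G M ρ x _ ρx = producers-≤3 M ρx , producer-pairs-≤3 M ρx
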